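{- For any $k$-CNF $F$ with $S \ge 1$ solutions, there exists a partial assignment $a$ such that $|V(a)| = \lceil \log_2 S \rceil$ and $F_a$ has exactly one solution.
   Context: A literal is $x$ or $\bar x$; a clause is a finite set of literals over distinct variables; a CNF is a finite set of clauses, a $k$-CNF if every clause has at most $k$ literals. A partial assignment $a$ is a set of literals over distinct variables of $F$; $V(a)$ is the set of variables of its literals. $F_a$ is obtained from $F$ by deleting every clause containing a literal of $a$ and deleting from the remaining clauses every literal whose negation is in $a$. A solution of $F$ is an assignment to all variables of $F$ satisfying all clauses; a solution of $F_a$ is an assignment to the variables of $F$ not in $V(a)$ which together with $a$ is a solution of $F$. -}

module Defs where

open import Data.Nat using (ℕ; zero; suc; _+_; _≤_)
open import Data.Bool using (Bool; true; false; not; _∧_; _∨_; if_then_else_)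
open import Data.Fin using (Fin)
open import Data.Vec using (Vec; []; _∷_; lookup)
open import Data.List using (List; []; _∷_; _++_; map; length)
open import Data.List.Relation.Unary.All using (All)
open import Data.List.Relation.Unary.Any using (Any)
open import Data.List.Relation.Unary.Unique.Propositional using (Unique)
open import Data.List.Membership.Propositional using (_∈_)
open import Data.Product using (Σ; _×_; ∃)
open import Relation.Binary.PropositionalEquality using (_≡_)

data Literal (n : ℕ) : Set where
  pos : Fin n → Literal n
  neg : Fin n → Literal n

var : ∀ {n} → Literal n → Fin n
var (pos i) = i
var (neg i) = i

Clause : ℕ → Set
Clause n = List (Literal n)

CNF : ℕ → Set
CNF n = List (Clause n)

IsClause : ∀ {n} → Clause n → Set
IsClause c = Unique (map var c)

IsKCNF : ∀ {n} → ℕ → CNF n → Set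
IsKCNF k F = All (λ c → IsClause c × length c ≤ k) F

-- Every variable among Fin n actually occurs in F, so that Fin n is exactly
-- the variable set of F.
AllVarsOccur : ∀ {n} → CNF n → Set
AllVarsOccur {n} F = (i : Fin n) → Any (λ c → i ∈ map var c) F

Assignment : ℕ → Set
Assignment n = Vec Bool n

evalLit : ∀ {n} → Assignment n → Literal n → Bool
evalLit σ (pos i) = lookup σ i
evalLit σ (neg i) = not (lookup σ i)

evalClause : ∀ {n} → Assignment n → Clause n → Bool
evalClause σ [] = false
evalClause σ (l ∷ c) = evalLit σ l ∨ evalClause σ c

evalCNF : ∀ {n} → Assignment n → CNF n → Bool
evalCNF σ [] = true
evalCNF σ (c ∷ F) = evalClause σ c ∧ evalCNF σ F

IsSolution : ∀ {n} → CNF n → Assignment n → Set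
IsSolution F σ = evalCNF σ F ≡ true

allAssignments : (n : ℕ) → List (Assignment n)
allAssignments zero = [] ∷ []
allAssignments (suc n) =
  map (true ∷_) (allAssignments n) ++ map (false ∷_) (allAssignments n)

countTrue : ∀ {A : Set} → (A → Bool) → List A → ℕ
countTrue p [] = 0
countTrue p (x ∷ xs) = (if p x then 1 else 0) + countTrue p xs

numSolutions : ∀ {n} → CNF n → ℕ
numSolutions {n} F = countTrue (λ σ → evalCNF σ F) (allAssignments n)

-- A partial assignment: a list of literals over pairwise distinct variables.
-- |V(a)| is then its length.
PartialAssignment : ℕ → Set
PartialAssignment n = List (Literal n)

IsPartialAssignment : ∀ {n} → PartialAssignment n → Set
IsPartialAssignment a = Unique (map var a)

Extends : ∀ {n} → Assignment n → PartialAssignment n → Set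
Extends σ a = All (λ l → evalLit σ l ≡ true) a

-- Solutions of F_a correspond exactly to total assignments σ extending a
-- that solve F (σ restricted to the variables outside V(a)).
-- F_a has exactly one solution:
HasUniqueSolutionUnder : ∀ {n} → CNF n → PartialAssignment n → Set
HasUniqueSolutionUnder F a =
  Σ _ λ σ → (Extends σ a × IsSolution F σ) ×
    (∀ τ → Extends τ a → IsSolution F τ → τ ≡ σ)

-- Split on the first variable. If one of the two halves has no solutions the
-- variable can be left free; otherwise fixing it to the half with fewer
-- solutions keeps at most half of them. So by induction on the number of
-- variables, with S ≤ 2 ^ m and m ≤ n, m literals isolate a single solution;
-- m = ⌈log₂ S⌉ satisfies both bounds.
module Submission where

open import Defs
open import Data.Nat using (ℕ; zero; suc; _+_; _*_; _^_; _≤_; _<_; z≤n; s≤s; ⌈_/2⌉; ⌊_/2⌋)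
open import Data.Nat.Properties
open import Data.Nat.Logarithm using (⌈log₂_⌉; ⌈log₂⌉-mono-≤; ⌈log₂2^n⌉≡n)
open import Data.Nat.Logarithm.Core using (⌈log2⌉)
open import Induction.WellFounded using (Acc; acc)
open import Data.Bool using (Bool; true; false; not; if_then_else_)
open import Data.Bool.Properties using (¬-not) renaming (_≟_ to _≟ᵇ_)
open import Data.Fin using (zero; suc)
import Data.Fin.Properties as Fin
open import Data.Vec using ([]; _∷_)
open import Data.List using ([]; _∷_; _++_; map; length)
open import Data.List.Properties using (length-map; map-∘; map-cong)
open import Data.List.Relation.Unary.All as All using (All; []; _∷_)
import Data.List.Relation.Unary.All.Properties as All
open import Data.List.Relation.Unary.AllPairs using ([]; _∷_)
open import Data.List.Relation.Unary.Unique.Propositional using (Unique)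
import Data.List.Relation.Unary.Unique.Propositional.Properties as Unique
open import Data.Product using (Σ; _×_; _,_)
open import Data.Sum using (_⊎_; inj₁; inj₂)
open import Relation.Nullary using (yes; no; contradiction)
open import Relation.Binary.PropositionalEquality

count : ∀ {n} → (Assignment n → Bool) → ℕ
count {n} p = countTrue p (allAssignments n)

countTrue-++ : ∀ {A : Set} (p : A → Bool) xs ys →
  countTrue p (xs ++ ys) ≡ countTrue p xs + countTrue p ys
countTrue-++ p []       ys = refl
countTrue-++ p (x ∷ xs) ys =
  trans (cong (_ +_) (countTrue-++ p xs ys)) (sym (+-assoc (if p x then 1 else 0) _ _))

countTrue-map : ∀ {A B : Set} (p : B → Bool) (f : A → B) xs →
  countTrue p (map f xs) ≡ countTrue (λ x → p (f x)) xs
countTrue-map p f []       = refl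
countTrue-map p f (x ∷ xs) = cong (_ +_) (countTrue-map p f xs)

count-suc : ∀ {n} (p : Assignment (suc n) → Bool) →
  count p ≡ count (λ σ → p (true ∷ σ)) + count (λ σ → p (false ∷ σ))
count-suc {n} p = begin
  countTrue p (map (true ∷_) (allAssignments n) ++ map (false ∷_) (allAssignments n))
    ≡⟨ countTrue-++ p (map (true ∷_) (allAssignments n)) _ ⟩
  countTrue p (map (true ∷_) (allAssignments n)) + countTrue p (map (false ∷_) (allAssignments n))
    ≡⟨ cong₂ _+_ (countTrue-map p (true ∷_) (allAssignments n))
                 (countTrue-map p (false ∷_) (allAssignments n)) ⟩
  count (λ σ → p (true ∷ σ)) + count (λ σ → p (false ∷ σ)) ∎
  where open ≡-Reasoning

count-split : ∀ {n} (p : Assignment (suc n) → Bool) (b : Bool) →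
  count p ≡ count (λ σ → p (b ∷ σ)) + count (λ σ → p (not b ∷ σ))
count-split p true  = count-suc p
count-split p false =
  trans (count-suc p) (+-comm (count (λ σ → p (true ∷ σ))) (count (λ σ → p (false ∷ σ))))

count≤2^n : ∀ {n} (p : Assignment n → Bool) → count p ≤ 2 ^ n
count≤2^n {zero}  p with p []
... | true  = s≤s z≤n
... | false = z≤n
count≤2^n {suc n} p = begin
  count p
    ≡⟨ count-suc p ⟩
  count (λ σ → p (true ∷ σ)) + count (λ σ → p (false ∷ σ))
    ≤⟨ +-mono-≤ (count≤2^n (λ σ → p (true ∷ σ))) (count≤2^n (λ σ → p (false ∷ σ))) ⟩
  2 ^ n + 2 ^ n
    ≡⟨ cong (2 ^ n +_) (sym (+-identityʳ _)) ⟩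
  2 ^ suc n ∎
  where open ≤-Reasoning

satisfiable⇒count>0 : ∀ {n} (p : Assignment n → Bool) σ → p σ ≡ true → 0 < count p
satisfiable⇒count>0 p []          pσ rewrite pσ = s≤s z≤n
satisfiable⇒count>0 p (true ∷ σ)  pσ rewrite count-suc p =
  ≤-trans (satisfiable⇒count>0 (λ τ → p (true ∷ τ)) σ pσ) (m≤m+n _ _)
satisfiable⇒count>0 p (false ∷ σ) pσ rewrite count-suc p =
  ≤-trans (satisfiable⇒count>0 (λ τ → p (false ∷ τ)) σ pσ) (m≤n+m _ _)

n≤2*⌈n/2⌉ : ∀ n → n ≤ 2 * ⌈ n /2⌉
n≤2*⌈n/2⌉ n = begin
  n                       ≡⟨ sym (⌊n/2⌋+⌈n/2⌉≡n n) ⟩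
  ⌊ n /2⌋ + ⌈ n /2⌉       ≤⟨ +-monoˡ-≤ ⌈ n /2⌉ (⌊n/2⌋≤⌈n/2⌉ n) ⟩
  ⌈ n /2⌉ + ⌈ n /2⌉       ≡⟨ cong (⌈ n /2⌉ +_) (sym (+-identityʳ _)) ⟩
  2 * ⌈ n /2⌉             ∎
  where open ≤-Reasoning

n≤2^⌈log2⌉n : ∀ n (rec : Acc _<_ n) → n ≤ 2 ^ ⌈log2⌉ n rec
n≤2^⌈log2⌉n 0             _        = z≤n
n≤2^⌈log2⌉n 1             _        = s≤s z≤n
n≤2^⌈log2⌉n (suc (suc n)) (acc rs) = begin
  2 + n                  ≤⟨ +-monoʳ-≤ 2 (n≤2*⌈n/2⌉ n) ⟩
  2 + 2 * ⌈ n /2⌉        ≡⟨ sym (*-distribˡ-+ 2 1 ⌈ n /2⌉) ⟩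
  2 * (1 + ⌈ n /2⌉)      ≤⟨ *-monoʳ-≤ 2 (n≤2^⌈log2⌉n (suc ⌈ n /2⌉) _) ⟩
  2 ^ ⌈log2⌉ (2 + n) (acc rs) ∎
  where open ≤-Reasoning

n≤2^⌈log₂n⌉ : ∀ n → n ≤ 2 ^ ⌈log₂ n ⌉
n≤2^⌈log₂n⌉ n = n≤2^⌈log2⌉n n _

⌈log₂count⌉≤n : ∀ {n} (p : Assignment n → Bool) → ⌈log₂ count p ⌉ ≤ n
⌈log₂count⌉≤n {n} p = subst (⌈log₂ count p ⌉ ≤_) (⌈log₂2^n⌉≡n n) (⌈log₂⌉-mono-≤ (count≤2^n p))

smaller-side : (f : Bool → ℕ) → Σ Bool λ b → f b ≤ f (not b)
smaller-side f with f true ≤? f false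
... | yes t≤f = true  , t≤f
... | no  t≰f = false , <⇒≤ (≰⇒> t≰f)

smaller-summand≤half : ∀ {m n k} → m ≤ n → m + n ≤ 2 * k → m ≤ k
smaller-summand≤half {m} m≤n m+n≤2k =
  *-cancelˡ-≤ 2 (≤-trans (+-monoʳ-≤ m (≤-trans (≤-reflexive (+-identityʳ m)) m≤n)) m+n≤2k)

shift : ∀ {n} → Literal n → Literal (suc n)
shift (pos i) = pos (suc i)
shift (neg i) = neg (suc i)

var-shift : ∀ {n} (l : Literal n) → var (shift l) ≡ suc (var l)
var-shift (pos i) = refl
var-shift (neg i) = refl

evalLit-shift : ∀ {n} c (σ : Assignment n) l → evalLit (c ∷ σ) (shift l) ≡ evalLit σ l
evalLit-shift c σ (pos i) = refl
evalLit-shift c σ (neg i) = refl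

map-var-shift : ∀ {n} (a : PartialAssignment n) → map var (map shift a) ≡ map suc (map var a)
map-var-shift a = begin
  map var (map shift a)       ≡⟨ sym (map-∘ a) ⟩
  map (λ l → var (shift l)) a ≡⟨ map-cong var-shift a ⟩
  map (λ l → suc (var l)) a   ≡⟨ map-∘ a ⟩
  map suc (map var a)         ∎
  where open ≡-Reasoning

shift-partialAssignment : ∀ {n} {a : PartialAssignment n} →
  IsPartialAssignment a → IsPartialAssignment (map shift a)
shift-partialAssignment {a = a} a-pa =
  subst Unique (sym (map-var-shift a)) (Unique.map⁺ Fin.suc-injective a-pa)

shift-avoids-zero : ∀ {n} (a : PartialAssignment n) → All (zero ≢_) (map var (map shift a))
shift-avoids-zero a =
  subst (All (zero ≢_)) (sym (map-var-shift a)) (All.map⁺ (All.universal (λ _ ()) (map var a)))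

extends-shift⁺ : ∀ {n} c {σ : Assignment n} {a} → Extends σ a → Extends (c ∷ σ) (map shift a)
extends-shift⁺ c {σ} σ⊇a = All.map⁺ (All.map (λ {l} → trans (evalLit-shift c σ l)) σ⊇a)

extends-shift⁻ : ∀ {n} c {σ : Assignment n} {a} → Extends (c ∷ σ) (map shift a) → Extends σ a
extends-shift⁻ c {σ} σ⊇a = All.map (λ {l} → trans (sym (evalLit-shift c σ l))) (All.map⁻ σ⊇a)

literal₀ : ∀ {n} → Bool → Literal (suc n)
literal₀ true  = pos zero
literal₀ false = neg zero

literal₀-holds : ∀ {n} b (σ : Assignment n) → evalLit (b ∷ σ) (literal₀ b) ≡ true
literal₀-holds true  σ = refl
literal₀-holds false σ = refl

literal₀-forces : ∀ {n} b c (σ : Assignment n) → evalLit (c ∷ σ) (literal₀ b) ≡ true → c ≡ b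
literal₀-forces true  true  σ _ = refl
literal₀-forces false false σ _ = refl

literal₀-∷-shift : ∀ {n} b {a : PartialAssignment n} →
  IsPartialAssignment a → IsPartialAssignment (literal₀ b ∷ map shift a)
literal₀-∷-shift true  {a} a-pa = shift-avoids-zero a ∷ shift-partialAssignment a-pa
literal₀-∷-shift false {a} a-pa = shift-avoids-zero a ∷ shift-partialAssignment a-pa

-- HasUniqueSolutionUnder F a is definitionally Isolates (λ σ → evalCNF σ F) a.
Isolates : ∀ {n} → (Assignment n → Bool) → PartialAssignment n → Set
Isolates {n} p a = Σ (Assignment n) λ σ → (Extends σ a × p σ ≡ true) ×
  (∀ τ → Extends τ a → p τ ≡ true → τ ≡ σ)

IsolatingAssignment : ∀ {n} → (Assignment n → Bool) → ℕ → Set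
IsolatingAssignment {n} p m =
  Σ (PartialAssignment n) λ a → IsPartialAssignment a × length a ≡ m × Isolates p a

isolating-fix₀ : ∀ {n m} {p : Assignment (suc n) → Bool} b →
  IsolatingAssignment (λ σ → p (b ∷ σ)) m → IsolatingAssignment p (suc m)
isolating-fix₀ {p = p} b (a , a-pa , refl , σ , (σ⊇a , pσ) , unique) =
  literal₀ b ∷ map shift a , literal₀-∷-shift b a-pa , cong suc (length-map shift a) ,
  b ∷ σ , (literal₀-holds b σ ∷ extends-shift⁺ b σ⊇a , pσ) , unique′
  where
  unique′ : ∀ τ → Extends τ (literal₀ b ∷ map shift a) → p τ ≡ true → τ ≡ b ∷ σ
  unique′ (c ∷ τ) (c⊨b ∷ τ⊇a) pτ with refl ← literal₀-forces b c τ c⊨b =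
    cong (b ∷_) (unique τ (extends-shift⁻ b τ⊇a) pτ)

isolating-skip₀ : ∀ {n m} {p : Assignment (suc n) → Bool} b →
  count (λ σ → p (b ∷ σ)) ≡ 0 →
  IsolatingAssignment (λ σ → p (not b ∷ σ)) m → IsolatingAssignment p m
isolating-skip₀ {p = p} b none (a , a-pa , |a|≡m , σ , (σ⊇a , pσ) , unique) =
  map shift a , shift-partialAssignment a-pa , trans (length-map shift a) |a|≡m ,
  not b ∷ σ , (extends-shift⁺ (not b) σ⊇a , pσ) , unique′
  where
  unique′ : ∀ τ → Extends τ (map shift a) → p τ ≡ true → τ ≡ not b ∷ σ
  unique′ (c ∷ τ) τ⊇a pτ with c ≟ᵇ b
  ... | yes refl = contradiction (subst (0 <_) none (satisfiable⇒count>0 _ τ pτ)) (n≮n 0)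
  ... | no  c≢b with refl ← ¬-not c≢b = cong (not b ∷_) (unique τ (extends-shift⁻ (not b) τ⊇a) pτ)

Isolable : ℕ → Set
Isolable n = ∀ {m} (p : Assignment n → Bool) →
  0 < count p → count p ≤ 2 ^ m → m ≤ n → IsolatingAssignment p m

isolable-zero : Isolable zero
isolable-zero p 0<S _ z≤n with p [] in p[]≡true
isolable-zero p 0<S _ z≤n | true = [] , [] , refl , [] , ([] , p[]≡true) , λ { [] _ _ → refl }
isolable-zero p () _ z≤n  | false

isolable-one-sided : ∀ {n m} → Isolable n → (p : Assignment (suc n) → Bool) (b : Bool) →
  count (λ σ → p (b ∷ σ)) ≡ 0 →
  0 < count p → count p ≤ 2 ^ m → m ≤ suc n → IsolatingAssignment p m
isolable-one-sided {n} {m} ih p b none 0<S S≤2^m m≤1+n = by-cases (m≤n⇒m<n∨m≡n m≤1+n)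
  where
  other : Assignment n → Bool
  other σ = p (not b ∷ σ)
  S≡r : count p ≡ count other
  S≡r = trans (count-split p b) (cong (_+ count other) none)
  by-cases : m < suc n ⊎ m ≡ suc n → IsolatingAssignment p m
  by-cases (inj₁ (s≤s m≤n)) =
    isolating-skip₀ b none (ih other (subst (0 <_) S≡r 0<S) (subst (_≤ 2 ^ m) S≡r S≤2^m) m≤n)
  -- Leaving the variable free needs m ≤ n; for m = 1 + n a literal is spent instead.
  by-cases (inj₂ m≡1+n) = subst (IsolatingAssignment p) (sym m≡1+n)
    (isolating-fix₀ (not b) (ih other (subst (0 <_) S≡r 0<S) (count≤2^n other) ≤-refl))

isolable-two-sided : ∀ {n m} → Isolable n → (p : Assignment (suc n) → Bool) (b : Bool) →
  0 < count (λ σ → p (b ∷ σ)) → count (λ σ → p (b ∷ σ)) ≤ count (λ σ → p (not b ∷ σ)) →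
  count p ≤ 2 ^ m → m ≤ suc n → IsolatingAssignment p m
isolable-two-sided ih p b 0<s s≤r S≤2^m m≤1+n
  rewrite count-split p b with m≤1+n
... | z≤n      = contradiction (≤-trans (+-mono-≤ 0<s (≤-trans 0<s s≤r)) S≤2^m) λ { (s≤s ()) }
... | s≤s m′≤n = isolating-fix₀ b (ih _ 0<s (smaller-summand≤half s≤r S≤2^m) m′≤n)

isolable-suc : ∀ {n} → Isolable n → Isolable (suc n)
isolable-suc ih p 0<S S≤2^m m≤1+n
  with b , s≤r ← smaller-side (λ b → count (λ σ → p (b ∷ σ)))
  with count (λ σ → p (b ∷ σ)) ≟ 0
... | yes none = isolable-one-sided ih p b none 0<S S≤2^m m≤1+n
... | no  some = isolable-two-sided ih p b (n≢0⇒n>0 some) s≤r S≤2^m m≤1+n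

isolable : ∀ n → Isolable n
isolable zero    = isolable-zero
isolable (suc n) = isolable-suc (isolable n)

lemma4p1 : (k n : ℕ) (F : CNF n) → IsKCNF k F → AllVarsOccur F →
    1 ≤ numSolutions F →
    Σ (PartialAssignment n) λ a → IsPartialAssignment a ×
      length a ≡ ⌈log₂ numSolutions F ⌉ × HasUniqueSolutionUnder F a
lemma4p1 k n F _ _ 0<S =
  isolable n solves 0<S (n≤2^⌈log₂n⌉ (count solves)) (⌈log₂count⌉≤n solves)
  where
  solves : Assignment n → Bool
  solves σ = evalCNF σ F
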